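{- Suppose $m<n$ are elements of $\mathbf{K}$ with $U(m)=U(n)$, and let $f\in\mathrm{OEmb}(\mathbf{K},\mathbf{K})$. Then $\ell(c(f(m))\wedge c(f(n)))\le f(\ell(c(m)\wedge c(n)))$.
   Context: Setting: finite relational language $\mathcal{L}=\{U_i:i<k^{\mathsf{u}}\}\cup\{R_i:i<k\}$ with conventions: each vertex satisfies exactly one $U_i$ ($U(a)=i$); $R_i(a,a)$ never; distinct $a,b$ satisfy exactly one $R_i(a,b)$ ($R(a,b)=i$); an involution $\mathrm{Flip}$ of $k$ fixing $0$ with $R_i(a,b)\iff R_{\mathrm{Flip}(i)}(b,a)$. $\mathbf{K}$ is an $\mathcal{L}$-structure with underlying set $\omega$ (in the paper, a fixed enumerated left-dense Fra\"iss\'e limit of $\mathrm{Forb}(\mathcal{F})$ for a finite set $\mathcal{F}$ of finite irreducible structures). $\mathrm{OEmb}(\mathbf{K},\mathbf{K})$ is the set of order-preserving (w.r.t. the usual order of $\omega$) embeddings of $\mathbf{K}$ into itself. $T=k^{\mathsf{u}}\times k^{<\omega}$, $t=(t^{\mathsf{u}},t^{\mathsf{b}})$, $\ell(t)=|t^{\mathsf{b}}|$; for $s^{\mathsf{u}}=t^{\mathsf{u}}$, $s\wedge t$ is the longest common initial segment (same unary, longest common initial segment of the binary parts). The coding map $c:\mathbf{K}\to T$ is given by $c(n)^{\mathsf{u}}=U(n)$, $\ell(c(n))=n$, $c(n)^{\mathsf{b}}(m)=R(n,m)$ for $m<n$. -}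

module Defs where

open import Data.Nat using (ℕ; zero; suc; _<_)
open import Data.Fin using (Fin; toℕ)
open import Data.List using (List; []; _∷_; map; upTo; length)
open import Data.Product using (_×_; _,_; proj₁; proj₂)
open import Relation.Binary.PropositionalEquality using (_≡_; _≢_)
open import Relation.Nullary using (yes; no)
open import Data.Fin.Properties using (_≟_)

-- An L-structure with underlying set ω (= ℕ), for L = {U_i : i < ku} ∪ {R_i : i < k}.
-- Each vertex satisfies exactly one U_i: encoded as the function U (U a = i iff U_i(a)).
-- Distinct a, b satisfy exactly one R_i(a,b): encoded as the function R
-- (R a b = i iff R_i(a,b) for a ≠ b; the value R a a carries no meaning,
-- since R_i(a,a) never holds).
record Structure (ku k : ℕ) : Set where
  field
    U          : ℕ → Fin ku
    R          : ℕ → ℕ → Fin k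
    Flip       : Fin k → Fin k
    Flip-invol : ∀ i → Flip (Flip i) ≡ i
    Flip-0     : ∀ (i : Fin k) → toℕ i ≡ 0 → Flip i ≡ i
    Flip-law   : ∀ a b → a ≢ b → R b a ≡ Flip (R a b)

record OEmb {ku k : ℕ} (K : Structure ku k) (f : ℕ → ℕ) : Set where
  open Structure K
  field
    order-pres : ∀ a b → a < b → f a < f b
    U-pres     : ∀ a → U (f a) ≡ U a
    R-pres     : ∀ a b → a ≢ b → R (f a) (f b) ≡ R a b

T : ℕ → ℕ → Set
T ku k = Fin ku × List (Fin k)

ℓ : ∀ {ku k} → T ku k → ℕ
ℓ t = length (proj₂ t)

commonPrefix : ∀ {k} → List (Fin k) → List (Fin k) → List (Fin k)
commonPrefix []       _        = []
commonPrefix (_ ∷ _)  []       = []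
commonPrefix (x ∷ xs) (y ∷ ys) with x ≟ y
... | yes _ = x ∷ commonPrefix xs ys
... | no  _ = []

_∧_ : ∀ {ku k} → T ku k → T ku k → T ku k
s ∧ t = proj₁ s , commonPrefix (proj₂ s) (proj₂ t)

c : ∀ {ku k} → Structure ku k → ℕ → T ku k
c K n = U n , map (R n) (upTo n)
  where open Structure K

-- Let d = ℓ(c(m) ∧ c(n)) ≤ m.  If d = m, the bound is just ℓ(c(f(m))) = f(m).
-- Otherwise c(m) and c(n) first differ at position d, i.e. R(m,d) ≠ R(n,d).  Since f
-- preserves R and the order, f(d) < f(m) < f(n) and R(f(m),f(d)) ≠ R(f(n),f(d)), so
-- c(f(m)) and c(f(n)) already differ at position f(d).
module Submission where

open import Defs
open import Data.Nat using (ℕ; _<_; _≤_; zero; suc; z≤n; s≤s)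
open import Data.Nat.Properties using (_<?_; ≤∧≮⇒≡; <-trans; >⇒≢)
open import Data.Fin using (Fin)
open import Data.Fin.Properties using (_≟_)
open import Data.List using (List; []; _∷_; applyUpTo; length)
open import Data.List.Properties using (length-applyUpTo; map-upTo)
open import Function using (_∘_)
open import Relation.Binary.PropositionalEquality using (_≡_; _≢_; sym; cong₂; subst)
open import Relation.Nullary using (yes; no; contradiction)

module _ {k : ℕ} where

  length-commonPrefix-≤ˡ : (xs ys : List (Fin k)) → length (commonPrefix xs ys) ≤ length xs
  length-commonPrefix-≤ˡ []       _        = z≤n
  length-commonPrefix-≤ˡ (_ ∷ _)  []       = z≤n
  length-commonPrefix-≤ˡ (x ∷ xs) (y ∷ ys) with x ≟ y
  ... | yes _ = s≤s (length-commonPrefix-≤ˡ xs ys)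
  ... | no  _ = z≤n

  length-commonPrefix-applyUpTo-≤ : ∀ (g h : ℕ → Fin k) {a b} i → i < a → i < b → g i ≢ h i →
    length (commonPrefix (applyUpTo g a) (applyUpTo h b)) ≤ i
  length-commonPrefix-applyUpTo-≤ g h {suc _} {suc _} i i<a i<b gi≢hi with g 0 ≟ h 0 | i | i<a | i<b
  ... | no  _   | _     | _         | _         = z≤n
  ... | yes g≡h | zero  | _         | _         = contradiction g≡h gi≢hi
  ... | yes _   | suc j | s≤s j<a   | s≤s j<b   =
    s≤s (length-commonPrefix-applyUpTo-≤ (g ∘ suc) (h ∘ suc) j j<a j<b gi≢hi)

  applyUpTo-differ-at-commonPrefix : ∀ (g h : ℕ → Fin k) {a b} →
    let d = length (commonPrefix (applyUpTo g a) (applyUpTo h b)) in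
    d < a → d < b → g d ≢ h d
  applyUpTo-differ-at-commonPrefix g h {suc _} {suc _} d<a d<b with g 0 ≟ h 0 | d<a | d<b
  ... | yes _   | s≤s d<a′ | s≤s d<b′ = applyUpTo-differ-at-commonPrefix (g ∘ suc) (h ∘ suc) d<a′ d<b′
  ... | no  g≢h | _        | _        = g≢h

module _ {ku k : ℕ} (K : Structure ku k) where
  open Structure K

  ℓ-c-∧-≡ : ∀ m n → ℓ (c K m ∧ c K n) ≡ length (commonPrefix (applyUpTo (R m) m) (applyUpTo (R n) n))
  ℓ-c-∧-≡ m n = cong₂ (λ xs ys → length (commonPrefix xs ys)) (map-upTo (R m) m) (map-upTo (R n) n)

  ℓ-c-∧-≤ˡ : ∀ m n → ℓ (c K m ∧ c K n) ≤ m
  ℓ-c-∧-≤ˡ m n rewrite ℓ-c-∧-≡ m n =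
    subst (length (commonPrefix (applyUpTo (R m) m) (applyUpTo (R n) n)) ≤_)
          (length-applyUpTo (R m) m)
          (length-commonPrefix-≤ˡ (applyUpTo (R m) m) (applyUpTo (R n) n))

  ℓ-c-∧-≤ : ∀ {m n} i → i < m → i < n → R m i ≢ R n i → ℓ (c K m ∧ c K n) ≤ i
  ℓ-c-∧-≤ {m} {n} i i<m i<n Rmi≢Rni rewrite ℓ-c-∧-≡ m n =
    length-commonPrefix-applyUpTo-≤ (R m) (R n) i i<m i<n Rmi≢Rni

  R-differ-at-ℓ-c-∧ : ∀ {m n} → let d = ℓ (c K m ∧ c K n) in d < m → m < n → R m d ≢ R n d
  R-differ-at-ℓ-c-∧ {m} {n} d<m m<n rewrite ℓ-c-∧-≡ m n =
    applyUpTo-differ-at-commonPrefix (R m) (R n) d<m (<-trans d<m m<n)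

lemma5p10 : ∀ {ku k : ℕ} (K : Structure ku k) (m n : ℕ) → m < n →
            Structure.U K m ≡ Structure.U K n →
            (f : ℕ → ℕ) → OEmb K f →
            ℓ (c K (f m) ∧ c K (f n)) ≤ f (ℓ (c K m ∧ c K n))
lemma5p10 K m n m<n _ f emb with ℓ (c K m ∧ c K n) <? m
... | no d≮m = subst (λ d → ℓ (c K (f m) ∧ c K (f n)) ≤ f d)
                    (sym (≤∧≮⇒≡ (ℓ-c-∧-≤ˡ K m n) d≮m))
                    (ℓ-c-∧-≤ˡ K (f m) (f n))
... | yes d<m =
  ℓ-c-∧-≤ K (f d) (order-pres d m d<m) (order-pres d n (<-trans d<m m<n)) images-differ
  where
    open Structure K
    open OEmb emb
    d = ℓ (c K m ∧ c K n)
    images-differ : R (f m) (f d) ≢ R (f n) (f d)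
    images-differ rewrite R-pres m d (>⇒≢ d<m) | R-pres n d (>⇒≢ (<-trans d<m m<n)) =
      R-differ-at-ℓ-c-∧ K d<m m<n
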